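{- Let $\Delta$ be a positive integer, let $m\in\{1,2,3\}$ and let $a,b\in\mathbb{Z}^m$ be such that $M(a,b)$ is a generic $\Delta$-submodular matrix of type $m$. Then $|M(a,b)|\leq\Delta+2$ if $m=1$, $|M(a,b)|\leq\Delta+3$ if $m=2$, and $|M(a,b)|\leq\Delta+4$ if $m=3$, where $|M(a,b)|$ is the number of columns.
   Context: All matrices are integer matrices with pairwise distinct columns. For $A\in\mathbb{Z}^{2\times n}$ of rank $2$, $A$ is $\Delta$-submodular if all its $2\times 2$ minors have absolute value at most $\Delta$, and generic if any two columns are linearly independent. For $a,b\in\mathbb{Z}^m$, $M(a,b)$ (a matrix of type $m$) is the $2$-row matrix whose columns are $(0,1)^\intercal$ together with all $(k,j)^\intercal$ with $k\in\{1,\dots,m\}$, $a_k\leq j\leq b_k$, $\gcd(j,k)=1$. -}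

module Defs where

open import Data.Nat as ℕ using (ℕ; zero; suc)
open import Data.Integer as ℤ using (ℤ; +_; -[1+_]; _+_; _-_; _*_; ∣_∣)
open import Data.Integer.GCD using (gcd)
open import Data.Fin using (Fin; toℕ)
open import Data.List using (List; []; _∷_; map; upTo; filter; concatMap; allFin; length; lookup)
open import Data.Product using (_×_; _,_; ∃₂)
open import Relation.Binary.PropositionalEquality using (_≡_; _≢_)
open import Relation.Nullary using (¬_)

Col : Set
Col = ℤ × ℤ

Mat : Set
Mat = List Col

det : Col → Col → ℤ
det (x₁ , y₁) (x₂ , y₂) = x₁ * y₂ - x₂ * y₁

clamp : ℤ → ℕ
clamp (+ n) = n
clamp -[1+ n ] = 0

range : ℤ → ℤ → List ℤ
range a b = map (λ i → a + + i) (upTo (clamp ((b - a) + + 1)))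

colsFor : ℕ → ℤ → ℤ → List Col
colsFor k a b = map (λ j → (+ k , j)) (filter (λ j → gcd j (+ k) ℤ.≟ + 1) (range a b))

M : (m : ℕ) → (Fin m → ℤ) → (Fin m → ℤ) → Mat
M m a b = (+ 0 , + 1) ∷ concatMap (λ i → colsFor (suc (toℕ i)) (a i) (b i)) (allFin m)

ncols : Mat → ℕ
ncols = length

Rank2 : Mat → Set
Rank2 A = ∃₂ λ (i j : Fin (length A)) → det (lookup A i) (lookup A j) ≢ + 0

Submodular : ℕ → Mat → Set
Submodular Δ A = Rank2 A × ((i j : Fin (length A)) → ∣ det (lookup A i) (lookup A j) ∣ ℕ.≤ Δ)

Generic : Mat → Set
Generic A = (i j : Fin (length A)) → i ≢ j → det (lookup A i) (lookup A j) ≢ + 0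

-- Group the columns (k , j) of M(a, b) into layers by their first entry k. If a nonempty layer
-- has extreme entries lo ≤ hi, it has at most hi - lo + 1 columns for k = 1, and, since no two
-- consecutive integers are odd and no three are prime to 3, at most (hi - lo)/2 + 1 for k = 2
-- and (2(hi - lo) + 4)/3 for k = 3. The minors between extreme columns give
-- det((k, lo), (l, hi′)) + det((l, lo′), (k, hi)) = k (hi′ - lo′) + l (hi - lo) ≤ 2Δ for any
-- two layers, and k (hi - lo) ≤ Δ within a layer. A positive combination of these linear
-- inequalities, measured against the top nonempty layer, bounds the number of columns.
module Submission where

open import Data.Fin using (Fin; zero; suc; toℕ)
open import Data.Integer as ℤ using (ℤ; +_; -[1+_]; _+_; _-_; _*_; _≤_; +≤+; -≤+)
open import Data.Integer.Divisibility.Signed using (_∣_; divides; ∣⇒∣ᵤ)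
open import Data.Integer.DivMod using (_%ℕ_; _/ℕ_; n%ℕd<d; a≡a%ℕn+[a/ℕn]*n)
open import Data.Integer.GCD using (gcd; gcd-greatest)
open import Data.Integer.Properties
open import Data.Integer.Tactic.RingSolver using (solve; solve-∀)
open import Data.List using (List; []; _∷_; map; applyUpTo; filter; concat; allFin; length)
open import Data.List.Membership.Propositional using (_∈_)
open import Data.List.Membership.Propositional.Properties using (∈-map⁺; ∈-concat⁺′; ∈-allFin; ∈-filter⁻)
open import Data.List.Properties using (map-applyUpTo; length-++; length-map; map-∘; map-cong)
open import Data.List.Relation.Unary.Any using (here; there; index)
open import Data.List.Relation.Unary.Any.Properties using (lookup-index)
open import Data.Nat as ℕ using (ℕ; z≤n; s≤s)
import Data.Nat.Divisibility as ℕ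
import Data.Nat.Properties as ℕ
open import Data.Nat.ListAction using (sum)
open import Data.Product using (_×_; _,_; ∃-syntax)
open import Data.Sum using (_⊎_; inj₁; inj₂)
open import Data.Empty using (⊥-elim)
open import Function using (_∘_; id)
open import Relation.Binary.PropositionalEquality
open import Relation.Nullary using (¬_; yes; no)
open import Relation.Nullary.Decidable using (from-yes)
open import Relation.Unary using (Decidable)

open import Defs

consecutive : ℤ → ℕ → List ℤ
consecutive a ℕ.zero    = []
consecutive a (ℕ.suc n) = a ∷ consecutive (a + + 1) n

applyUpTo≡consecutive : ∀ (f : ℕ → ℤ) a n → (∀ i → f i ≡ a + + i) → applyUpTo f n ≡ consecutive a n
applyUpTo≡consecutive f a ℕ.zero    _  = refl
applyUpTo≡consecutive f a (ℕ.suc n) f≗ = cong₂ _∷_ (trans (f≗ 0) (+-identityʳ a))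
  (applyUpTo≡consecutive (f ∘ ℕ.suc) (a + + 1) n (λ i → trans (f≗ (ℕ.suc i)) (sym (+-assoc a (+ 1) (+ i)))))

range≡consecutive : ∀ a b → range a b ≡ consecutive a (clamp ((b - a) + + 1))
range≡consecutive a b =
  trans (map-applyUpTo id (λ i → a + + i) _) (applyUpTo≡consecutive _ a _ (λ _ → refl))

consecutive-≥ : ∀ {a x} n → x ∈ consecutive a n → a ≤ x
consecutive-≥     (ℕ.suc n) (here refl) = ≤-refl
consecutive-≥ {a} (ℕ.suc n) (there x∈) = ≤-trans (i≤i+j a (+ 1)) (consecutive-≥ n x∈)

record Extent (Bound : ℤ → ℤ → ℤ → Set) (xs : List ℤ) : Set where
  constructor extent
  field
    lo hi : ℤ
    lo∈   : lo ∈ xs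
    hi∈   : hi ∈ xs
    lo≤hi : lo ≤ hi
    bound : Bound lo hi (+ length xs)

module _ {P : ℤ → Set} (P? : Decidable P) {Bound : ℤ → ℤ → ℤ → Set}
         (singleton : ∀ {x} → P x → Bound x x (+ 1))
         (extend : ∀ {x lo hi n} → P x → P lo → x + + 1 ≤ lo → Bound lo hi n → Bound x hi (+ 1 + n))
         where

  filter-consecutive-extent : ∀ a n →
    filter P? (consecutive a n) ≡ [] ⊎ Extent Bound (filter P? (consecutive a n))
  filter-consecutive-extent a ℕ.zero = inj₁ refl
  filter-consecutive-extent a (ℕ.suc n) with P? a | filter-consecutive-extent (a + + 1) n
  ... | no _   | rest    = rest
  ... | yes Pa | inj₁ xs≡[] =
    inj₂ (extent a a (here refl) (here refl) ≤-refl
                 (subst (λ xs → Bound a a (+ 1 + + length xs)) (sym xs≡[]) (singleton Pa)))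
  ... | yes Pa | inj₂ (extent lo hi lo∈ hi∈ lo≤hi b) with ∈-filter⁻ P? lo∈
  ...   | lo∈consecutive , Plo =
    inj₂ (extent a hi (here refl) (there hi∈) (≤-trans (i≤i+j a (+ 1)) (≤-trans a+1≤lo lo≤hi))
                 (extend Pa Plo a+1≤lo b))
    where
    a+1≤lo : a + + 1 ≤ lo
    a+1≤lo = consecutive-≥ n lo∈consecutive

  filter-range-extent : ∀ a b → filter P? (range a b) ≡ [] ⊎ Extent Bound (filter P? (range a b))
  filter-range-extent a b rewrite range≡consecutive a b = filter-consecutive-extent a (clamp ((b - a) + + 1))

CoprimeTo : ℕ → ℤ → Set
CoprimeTo k j = gcd j (+ k) ≡ + 1

coprimeTo? : ∀ k → Decidable (CoprimeTo k)
coprimeTo? k j = gcd j (+ k) ℤ.≟ + 1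

coprimesIn : ℕ → ℤ → ℤ → List ℤ
coprimesIn k a b = filter (coprimeTo? k) (range a b)

multiple-among-consecutive : ∀ k .{{_ : ℕ.NonZero k}} x → ∃[ i ] (i ℕ.< k × + k ∣ x + + i)
multiple-among-consecutive k x with x %ℕ k | n%ℕd<d x k | a≡a%ℕn+[a/ℕn]*n x k
... | ℕ.zero  | 0<k | x≡ = 0 , 0<k , divides (x /ℕ k) (begin
  x + + 0            ≡⟨ +-identityʳ x ⟩
  x                  ≡⟨ x≡ ⟩
  + 0 + x /ℕ k * + k ≡⟨ +-identityˡ _ ⟩
  x /ℕ k * + k       ∎)
  where open ≡-Reasoning
... | ℕ.suc r | 1+r<k | x≡ = i , ℕ.∸-monoʳ-< ℕ.z<s (ℕ.<⇒≤ 1+r<k) , divides (x /ℕ k + + 1) (begin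
  x + + i                          ≡⟨ cong (_+ + i) x≡ ⟩
  (+ ℕ.suc r + q * + k) + + i      ≡⟨ regroup (+ ℕ.suc r) (+ i) q (+ k) ⟩
  + (ℕ.suc r ℕ.+ i) + q * + k      ≡⟨ cong (λ n → + n + q * + k) (ℕ.m+[n∸m]≡n (ℕ.<⇒≤ 1+r<k)) ⟩
  + k + q * + k                    ≡⟨ distrib q (+ k) ⟩
  (q + + 1) * + k                  ∎)
  where
  open ≡-Reasoning
  q = x /ℕ k
  i = k ℕ.∸ ℕ.suc r
  regroup : ∀ s i q k → (s + q * k) + i ≡ (s + i) + q * k
  regroup = solve-∀
  distrib : ∀ q k → k + q * k ≡ (q + + 1) * k
  distrib = solve-∀

multiple⇒¬coprimeTo : ∀ {k x} → 2 ℕ.≤ k → + k ∣ x → ¬ CoprimeTo k x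
multiple⇒¬coprimeTo {k} {x} 2≤k k∣x gcd≡1 = ℕ.<⇒≱ 2≤k (ℕ.∣⇒≤ k∣1)
  where
  k∣1 : k ℕ.∣ 1
  k∣1 = subst (λ g → k ℕ.∣ ℤ.∣ g ∣) gcd≡1 (gcd-greatest {x} {+ k} {+ k} (∣⇒∣ᵤ k∣x) ℕ.∣-refl)

¬coprimeTo-among-consecutive : ∀ k .{{_ : ℕ.NonZero k}} x → 2 ℕ.≤ k →
  ∃[ i ] (i ℕ.< k × ¬ CoprimeTo k (x + + i))
¬coprimeTo-among-consecutive k x 2≤k with multiple-among-consecutive k x
... | i , i<k , k∣x+i = i , i<k , multiple⇒¬coprimeTo 2≤k k∣x+i

¬consecutive-coprimeTo-2 : ∀ {x} → CoprimeTo 2 x → ¬ CoprimeTo 2 (x + + 1)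
¬consecutive-coprimeTo-2 {x} c₀ c₁ with ¬coprimeTo-among-consecutive 2 x (s≤s (s≤s z≤n))
... | 0 , _ , ¬c = ¬c (subst (CoprimeTo 2) (sym (+-identityʳ x)) c₀)
... | 1 , _ , ¬c = ¬c c₁
... | ℕ.suc (ℕ.suc _) , s≤s (s≤s ()) , _

¬consecutive-coprimeTo-3 : ∀ {x} → CoprimeTo 3 x → CoprimeTo 3 (x + + 1) → ¬ CoprimeTo 3 (x + + 2)
¬consecutive-coprimeTo-3 {x} c₀ c₁ c₂ with ¬coprimeTo-among-consecutive 3 x (s≤s (s≤s z≤n))
... | 0 , _ , ¬c = ¬c (subst (CoprimeTo 3) (sym (+-identityʳ x)) c₀)
... | 1 , _ , ¬c = ¬c c₁
... | 2 , _ , ¬c = ¬c c₂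
... | ℕ.suc (ℕ.suc (ℕ.suc _)) , s≤s (s≤s (s≤s ())) , _

width-shift : ∀ {x lo} hi d → x + d ≤ lo → (hi - lo) + d ≤ hi - x
width-shift {x} {lo} hi d x+d≤lo = begin
  (hi - lo) + d             ≡⟨ solve (x ∷ lo ∷ hi ∷ d ∷ []) ⟩
  (hi - lo) + (x + d) - x   ≤⟨ +-monoˡ-≤ (ℤ.- x) (+-monoʳ-≤ (hi - lo) x+d≤lo) ⟩
  (hi - lo) + lo - x        ≡⟨ solve (x ∷ lo ∷ hi ∷ []) ⟩
  hi - x                    ∎
  where open ≤-Reasoning

gap-cases : ∀ {x lo} → x + + 1 ≤ lo → lo ≡ x + + 1 ⊎ x + + 2 ≤ lo
gap-cases {x} {lo} x+1≤lo with lo ℤ.≟ x + + 1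
... | yes lo≡x+1 = inj₁ lo≡x+1
... | no  lo≢x+1 = inj₂ (subst (_≤ lo) suc[x+1]≡x+2 (i<j⇒suc[i]≤j (≤∧≢⇒< x+1≤lo (lo≢x+1 ∘ sym))))
  where
  suc[x+1]≡x+2 : + 1 + (x + + 1) ≡ x + + 2
  suc[x+1]≡x+2 = solve (x ∷ [])

-- The second component of Bound₃, sharper when lo + 1 is a multiple of 3, is what lets the
-- induction add an element directly below lo.
Bound₁ Bound₂ Bound₃ : ℤ → ℤ → ℤ → Set
Bound₁ lo hi n = n ≤ (hi - lo) + + 1
Bound₂ lo hi n = + 2 * n ≤ (hi - lo) + + 2
Bound₃ lo hi n = (+ 3 * n ≤ + 2 * (hi - lo) + + 4)
               × (¬ CoprimeTo 3 (lo + + 1) → + 3 * n ≤ + 2 * (hi - lo) + + 3)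

singleton₁ : ∀ x → Bound₁ x x (+ 1)
singleton₁ x = ≤-reflexive (solve (x ∷ []))

extend₁ : ∀ {x lo hi n} → x + + 1 ≤ lo → Bound₁ lo hi n → Bound₁ x hi (+ 1 + n)
extend₁ {x} {lo} {hi} {n} gap n≤ = begin
  + 1 + n                  ≤⟨ +-monoʳ-≤ (+ 1) n≤ ⟩
  + 1 + ((hi - lo) + + 1)  ≡⟨ solve (lo ∷ hi ∷ []) ⟩
  ((hi - lo) + + 1) + + 1  ≤⟨ +-monoˡ-≤ (+ 1) (width-shift hi (+ 1) gap) ⟩
  (hi - x) + + 1           ∎
  where open ≤-Reasoning

singleton₂ : ∀ x → Bound₂ x x (+ 1)
singleton₂ x = ≤-reflexive (solve (x ∷ []))

extend₂ : ∀ {x lo hi n} → CoprimeTo 2 x → CoprimeTo 2 lo → x + + 1 ≤ lo → Bound₂ lo hi n → Bound₂ x hi (+ 1 + n)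
extend₂ {x} {lo} {hi} {n} cx clo gap 2n≤ with gap-cases {x} gap
... | inj₁ lo≡x+1 = ⊥-elim (¬consecutive-coprimeTo-2 {x} cx (subst (CoprimeTo 2) lo≡x+1 clo))
... | inj₂ x+2≤lo = begin
  + 2 * (+ 1 + n)          ≡⟨ solve (n ∷ []) ⟩
  + 2 * n + + 2            ≤⟨ +-monoˡ-≤ (+ 2) 2n≤ ⟩
  ((hi - lo) + + 2) + + 2  ≤⟨ +-monoˡ-≤ (+ 2) (width-shift hi (+ 2) x+2≤lo) ⟩
  (hi - x) + + 2           ∎
  where open ≤-Reasoning

singleton₃ : ∀ x → Bound₃ x x (+ 1)
singleton₃ x = ≤-trans (+≤+ (ℕ.n≤1+n 3)) (≤-reflexive (solve (x ∷ []))) , λ _ → ≤-reflexive (solve (x ∷ []))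

extend₃ : ∀ {x lo hi n} → CoprimeTo 3 x → CoprimeTo 3 lo → x + + 1 ≤ lo → Bound₃ lo hi n → Bound₃ x hi (+ 1 + n)
extend₃ {x} {lo} {hi} {n} cx clo gap (3n≤ , 3n≤′) with gap-cases {x} gap
... | inj₁ refl = adjacent , λ ¬clo → ⊥-elim (¬clo clo)
  where
  open ≤-Reasoning
  ¬coprime-lo+1 : ¬ CoprimeTo 3 ((x + + 1) + + 1)
  ¬coprime-lo+1 c = ¬consecutive-coprimeTo-3 {x} cx clo (subst (CoprimeTo 3) (+-assoc x (+ 1) (+ 1)) c)
  adjacent : + 3 * (+ 1 + n) ≤ + 2 * (hi - x) + + 4
  adjacent = begin
    + 3 * (+ 1 + n)                         ≡⟨ solve (n ∷ []) ⟩
    + 3 * n + + 3                           ≤⟨ +-monoˡ-≤ (+ 3) (3n≤′ ¬coprime-lo+1) ⟩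
    + 2 * (hi - (x + + 1)) + + 3 + + 3      ≡⟨ solve (x ∷ hi ∷ []) ⟩
    + 2 * (hi - x) + + 4                    ∎
... | inj₂ x+2≤lo = ≤-trans apart (+-monoʳ-≤ (+ 2 * (hi - x)) (+≤+ (ℕ.n≤1+n 3))) , λ _ → apart
  where
  open ≤-Reasoning
  apart : + 3 * (+ 1 + n) ≤ + 2 * (hi - x) + + 3
  apart = begin
    + 3 * (+ 1 + n)                   ≡⟨ solve (n ∷ []) ⟩
    + 3 * n + + 3                     ≤⟨ +-monoˡ-≤ (+ 3) 3n≤ ⟩
    + 2 * (hi - lo) + + 4 + + 3       ≡⟨ solve (lo ∷ hi ∷ []) ⟩
    + 2 * ((hi - lo) + + 2) + + 3     ≤⟨ +-monoˡ-≤ (+ 3) (*-monoˡ-≤-nonNeg (+ 2) (width-shift hi (+ 2) x+2≤lo)) ⟩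
    + 2 * (hi - x) + + 3              ∎

coprimesIn-extent₁ : ∀ a b → coprimesIn 1 a b ≡ [] ⊎ Extent Bound₁ (coprimesIn 1 a b)
coprimesIn-extent₁ = filter-range-extent (coprimeTo? 1) (λ {x} _ → singleton₁ x)
  (λ {x} {lo} {hi} {n} _ _ → extend₁ {x} {lo} {hi} {n})

coprimesIn-extent₂ : ∀ a b → coprimesIn 2 a b ≡ [] ⊎ Extent Bound₂ (coprimesIn 2 a b)
coprimesIn-extent₂ = filter-range-extent (coprimeTo? 2) (λ {x} _ → singleton₂ x)
  (λ {x} {lo} {hi} {n} → extend₂ {x} {lo} {hi} {n})

coprimesIn-extent₃ : ∀ a b → coprimesIn 3 a b ≡ [] ⊎ Extent Bound₃ (coprimesIn 3 a b)
coprimesIn-extent₃ = filter-range-extent (coprimeTo? 3) (λ {x} _ → singleton₃ x)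
  (λ {x} {lo} {hi} {n} → extend₃ {x} {lo} {hi} {n})

length-concat : ∀ {A : Set} (xss : List (List A)) → length (concat xss) ≡ sum (map length xss)
length-concat []         = refl
length-concat (xs ∷ xss) = trans (length-++ xs) (cong (length xs ℕ.+_) (length-concat xss))

ncols-M : ∀ m (a b : Fin m → ℤ) →
  ncols (M m a b) ≡ ℕ.suc (sum (map (λ i → length (coprimesIn (ℕ.suc (toℕ i)) (a i) (b i))) (allFin m)))
ncols-M m a b = cong ℕ.suc (trans (length-concat (map cols (allFin m)))
  (cong sum (trans (sym (map-∘ (allFin m))) (map-cong (λ i → length-map _ (coprimesIn _ (a i) (b i))) (allFin m)))))
  where
  cols : Fin m → List Col
  cols i = colsFor (ℕ.suc (toℕ i)) (a i) (b i)

∈-M : ∀ {m} (a b : Fin m → ℤ) (i : Fin m) {j} →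
  j ∈ coprimesIn (ℕ.suc (toℕ i)) (a i) (b i) → (+ ℕ.suc (toℕ i) , j) ∈ M m a b
∈-M a b i j∈ = there (∈-concat⁺′ (∈-map⁺ _ j∈) (∈-map⁺ _ (∈-allFin i)))

i≤+∣i∣ : ∀ i → i ≤ + ℤ.∣ i ∣
i≤+∣i∣ (+ n)    = ≤-refl
i≤+∣i∣ -[1+ n ] = -≤+

minor≤ : ∀ {Δ A} → Submodular Δ A → ∀ {x y} → x ∈ A → y ∈ A → det x y ≤ + Δ
minor≤ {Δ} (_ , bounded) {x} {y} x∈ y∈ = ≤-trans (i≤+∣i∣ (det x y))
  (+≤+ (subst₂ (λ u v → ℤ.∣ det u v ∣ ℕ.≤ Δ) (sym (lookup-index x∈)) (sym (lookup-index y∈))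
               (bounded (index x∈) (index y∈))))

det-same-level : ∀ k y y′ → det (k , y) (k , y′) ≡ k * (y′ - y)
det-same-level = unfolded
  where
  unfolded : ∀ k y y′ → k * y′ - k * y ≡ k * (y′ - y)
  unfolded = solve-∀

det-cross-levels : ∀ k l lo hi lo′ hi′ → det (k , lo) (l , hi′) + det (l , lo′) (k , hi) ≡ k * (hi′ - lo′) + l * (hi - lo)
det-cross-levels = unfolded
  where
  unfolded : ∀ k l lo hi lo′ hi′ → (k * hi′ - l * lo) + (l * hi - k * lo′) ≡ k * (hi′ - lo′) + l * (hi - lo)
  unfolded = solve-∀

≤-from-scaled : ∀ c d {S T} → d ℕ.< c → + c * + S ≤ + c * + T + + d → S ℕ.≤ T
≤-from-scaled c d {S} {T} d<c cS≤cT+d = ℕ.m<1+n⇒m≤n (ℕ.*-cancelˡ-< c S (ℕ.suc T) (begin-strict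
  c ℕ.* S          ≤⟨ drop‿+≤+ (subst₂ _≤_ (sym (pos-* c S)) (cong (_+ + d) (sym (pos-* c T))) cS≤cT+d) ⟩
  c ℕ.* T ℕ.+ d    <⟨ ℕ.+-monoʳ-< (c ℕ.* T) d<c ⟩
  c ℕ.* T ℕ.+ c    ≡⟨ ℕ.+-comm (c ℕ.* T) c ⟩
  c ℕ.+ c ℕ.* T    ≡⟨ ℕ.*-suc c T ⟨
  c ℕ.* ℕ.suc T    ∎))
  where open ℕ.≤-Reasoning

combine₂ : ∀ {n₁ n₂ w D} → + 2 * n₁ + w ≤ (D + D) + + 2 → + 2 * n₂ ≤ w + + 2 →
  + 2 * (n₁ + (n₂ + + 0)) ≤ + 2 * (D + + 2) + + 0
combine₂ {n₁} {n₂} {w} {D} h₁ h₂ = begin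
  + 2 * (n₁ + (n₂ + + 0))              ≡⟨ solve (n₁ ∷ n₂ ∷ w ∷ []) ⟩
  (+ 2 * n₁ + w) + + 2 * n₂ - w        ≤⟨ +-monoˡ-≤ (ℤ.- w) (+-mono-≤ h₁ h₂) ⟩
  ((D + D) + + 2) + (w + + 2) - w      ≡⟨ solve (w ∷ D ∷ []) ⟩
  + 2 * (D + + 2) + + 0                ∎
  where open ≤-Reasoning

combine₃ : ∀ {n₁ n₂ n₃ w D} → + 3 * n₁ + w ≤ (D + D) + + 3 → + 6 * n₂ + + 2 * w ≤ (D + D) + + 6 →
  + 3 * n₃ ≤ + 2 * w + + 4 → + 6 * (n₁ + (n₂ + (n₃ + + 0))) ≤ + 6 * (D + + 3) + + 2
combine₃ {n₁} {n₂} {n₃} {w} {D} h₁ h₂ h₃ = begin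
  + 6 * (n₁ + (n₂ + (n₃ + + 0)))
    ≡⟨ solve (n₁ ∷ n₂ ∷ n₃ ∷ w ∷ []) ⟩
  + 2 * (+ 3 * n₁ + w) + (+ 6 * n₂ + + 2 * w) + + 2 * (+ 3 * n₃) - + 4 * w
    ≤⟨ +-monoˡ-≤ (ℤ.- (+ 4 * w)) (+-mono-≤ (+-mono-≤ (*-monoˡ-≤-nonNeg (+ 2) h₁) h₂) (*-monoˡ-≤-nonNeg (+ 2) h₃)) ⟩
  + 2 * ((D + D) + + 3) + ((D + D) + + 6) + + 2 * (+ 2 * w + + 4) - + 4 * w
    ≡⟨ solve (w ∷ D ∷ []) ⟩
  + 6 * (D + + 3) + + 2
    ∎
  where open ≤-Reasoning

module Counting {Δ : ℕ} {A : Mat} (minor≤Δ : ∀ {x y} → x ∈ A → y ∈ A → det x y ≤ + Δ) where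

  data Layer (k : ℕ) (Bound : ℤ → ℤ → ℤ → Set) : List ℤ → Set where
    empty    : Layer k Bound []
    spanning : ∀ {L} lo hi → (+ k , lo) ∈ A → (+ k , hi) ∈ A → lo ≤ hi → Bound lo hi (+ length L) →
               Layer k Bound L

  layer : ∀ {k Bound L} → (∀ {j} → j ∈ L → (+ k , j) ∈ A) → L ≡ [] ⊎ Extent Bound L → Layer k Bound L
  layer _     (inj₁ refl)                          = empty
  layer cols∈ (inj₂ (extent lo hi lo∈ hi∈ lo≤hi b)) = spanning lo hi (cols∈ lo∈) (cols∈ hi∈) lo≤hi b

  width≤ : ∀ {k lo hi} → (+ ℕ.suc k , lo) ∈ A → (+ ℕ.suc k , hi) ∈ A → lo ≤ hi → hi - lo ≤ + Δ
  width≤ {k} {lo} {hi} lo∈ hi∈ lo≤hi = begin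
    hi - lo                            ≡⟨ *-identityˡ (hi - lo) ⟨
    + 1 * (hi - lo)                    ≤⟨ *-monoʳ-≤-nonNeg (hi - lo) {{ℤ.nonNegative (i≤j⇒0≤j-i lo≤hi)}} {+ 1} {+ ℕ.suc k} (+≤+ (s≤s z≤n)) ⟩
    + ℕ.suc k * (hi - lo)              ≡⟨ det-same-level (+ ℕ.suc k) lo hi ⟨
    det (+ ℕ.suc k , lo) (+ ℕ.suc k , hi) ≤⟨ minor≤Δ lo∈ hi∈ ⟩
    + Δ                                ∎
    where open ≤-Reasoning

  cross-width≤ : ∀ {k l lo hi lo′ hi′} → (+ k , lo) ∈ A → (+ k , hi) ∈ A → (+ l , lo′) ∈ A → (+ l , hi′) ∈ A →
    + k * (hi′ - lo′) + + l * (hi - lo) ≤ + Δ + + Δ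
  cross-width≤ {k} {l} {lo} {hi} {lo′} {hi′} lo∈ hi∈ lo′∈ hi′∈ = begin
    + k * (hi′ - lo′) + + l * (hi - lo)               ≡⟨ det-cross-levels (+ k) (+ l) lo hi lo′ hi′ ⟨
    det (+ k , lo) (+ l , hi′) + det (+ l , lo′) (+ k , hi) ≤⟨ +-mono-≤ (minor≤Δ lo∈ hi′∈) (minor≤Δ lo′∈ hi∈) ⟩
    + Δ + + Δ                                         ∎
    where open ≤-Reasoning

  Δ≤Δ+Δ+ : ∀ c → + Δ ≤ (+ Δ + + Δ) + + c
  Δ≤Δ+Δ+ c = +≤+ (ℕ.≤-trans (ℕ.m≤m+n Δ Δ) (ℕ.m≤m+n (Δ ℕ.+ Δ) c))

  -- A lower layer is measured against the width of the top nonempty layer; when it is empty,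
  -- the top layer's own minor suffices.
  below₁₂ : ∀ {L lo hi} → Layer 1 Bound₁ L → (+ 2 , lo) ∈ A → (+ 2 , hi) ∈ A → lo ≤ hi →
    + 2 * + length L + (hi - lo) ≤ (+ Δ + + Δ) + + 2
  below₁₂ {lo = lo} {hi} empty lo∈ hi∈ lo≤hi =
    subst (_≤ _) (sym (+-identityˡ (hi - lo))) (≤-trans (width≤ lo∈ hi∈ lo≤hi) (Δ≤Δ+Δ+ 2))
  below₁₂ {L} {lo} {hi} (spanning lo₁ hi₁ lo₁∈ hi₁∈ _ n≤) lo∈ hi∈ _ = begin
    + 2 * + length L + (hi - lo)                ≤⟨ +-monoˡ-≤ (hi - lo) (*-monoˡ-≤-nonNeg (+ 2) n≤) ⟩
    + 2 * ((hi₁ - lo₁) + + 1) + (hi - lo)       ≡⟨ solve (lo ∷ hi ∷ lo₁ ∷ hi₁ ∷ []) ⟩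
    (+ 1 * (hi - lo) + + 2 * (hi₁ - lo₁)) + + 2 ≤⟨ +-monoˡ-≤ (+ 2) (cross-width≤ lo₁∈ hi₁∈ lo∈ hi∈) ⟩
    (+ Δ + + Δ) + + 2                           ∎
    where open ≤-Reasoning

  below₁₃ : ∀ {L lo hi} → Layer 1 Bound₁ L → (+ 3 , lo) ∈ A → (+ 3 , hi) ∈ A → lo ≤ hi →
    + 3 * + length L + (hi - lo) ≤ (+ Δ + + Δ) + + 3
  below₁₃ {lo = lo} {hi} empty lo∈ hi∈ lo≤hi =
    subst (_≤ _) (sym (+-identityˡ (hi - lo))) (≤-trans (width≤ lo∈ hi∈ lo≤hi) (Δ≤Δ+Δ+ 3))
  below₁₃ {L} {lo} {hi} (spanning lo₁ hi₁ lo₁∈ hi₁∈ _ n≤) lo∈ hi∈ _ = begin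
    + 3 * + length L + (hi - lo)                ≤⟨ +-monoˡ-≤ (hi - lo) (*-monoˡ-≤-nonNeg (+ 3) n≤) ⟩
    + 3 * ((hi₁ - lo₁) + + 1) + (hi - lo)       ≡⟨ solve (lo ∷ hi ∷ lo₁ ∷ hi₁ ∷ []) ⟩
    (+ 1 * (hi - lo) + + 3 * (hi₁ - lo₁)) + + 3 ≤⟨ +-monoˡ-≤ (+ 3) (cross-width≤ lo₁∈ hi₁∈ lo∈ hi∈) ⟩
    (+ Δ + + Δ) + + 3                           ∎
    where open ≤-Reasoning

  below₂₃ : ∀ {L lo hi} → Layer 2 Bound₂ L → (+ 3 , lo) ∈ A → (+ 3 , hi) ∈ A → lo ≤ hi →
    + 6 * + length L + + 2 * (hi - lo) ≤ (+ Δ + + Δ) + + 6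
  below₂₃ {lo = lo} {hi} empty lo∈ hi∈ lo≤hi = begin
    + 6 * + 0 + + 2 * (hi - lo)  ≡⟨ solve (lo ∷ hi ∷ []) ⟩
    (hi - lo) + (hi - lo)        ≤⟨ +-mono-≤ (width≤ lo∈ hi∈ lo≤hi) (width≤ lo∈ hi∈ lo≤hi) ⟩
    + Δ + + Δ                    ≤⟨ i≤i+j (+ Δ + + Δ) (+ 6) ⟩
    (+ Δ + + Δ) + + 6            ∎
    where open ≤-Reasoning
  below₂₃ {L} {lo} {hi} (spanning lo₂ hi₂ lo₂∈ hi₂∈ _ 2n≤) lo∈ hi∈ _ = begin
    + 6 * + length L + + 2 * (hi - lo)           ≡⟨ cong (_+ + 2 * (hi - lo)) (*-assoc (+ 3) (+ 2) (+ length L)) ⟩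
    + 3 * (+ 2 * + length L) + + 2 * (hi - lo)   ≤⟨ +-monoˡ-≤ (+ 2 * (hi - lo)) (*-monoˡ-≤-nonNeg (+ 3) 2n≤) ⟩
    + 3 * ((hi₂ - lo₂) + + 2) + + 2 * (hi - lo)  ≡⟨ solve (lo ∷ hi ∷ lo₂ ∷ hi₂ ∷ []) ⟩
    (+ 2 * (hi - lo) + + 3 * (hi₂ - lo₂)) + + 6  ≤⟨ +-monoˡ-≤ (+ 6) (cross-width≤ lo₂∈ hi₂∈ lo∈ hi∈) ⟩
    (+ Δ + + Δ) + + 6                            ∎
    where open ≤-Reasoning

  layers₁-≤ : ∀ {L₁} → Layer 1 Bound₁ L₁ → length L₁ ℕ.+ 0 ℕ.≤ Δ ℕ.+ 1
  layers₁-≤ empty = z≤n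
  layers₁-≤ {L₁} (spanning lo hi lo∈ hi∈ lo≤hi n≤) = drop‿+≤+ (begin
    + length L₁ + + 0  ≡⟨ +-identityʳ (+ length L₁) ⟩
    + length L₁        ≤⟨ n≤ ⟩
    (hi - lo) + + 1    ≤⟨ +-monoˡ-≤ (+ 1) (width≤ lo∈ hi∈ lo≤hi) ⟩
    + Δ + + 1          ∎)
    where open ≤-Reasoning

  layers₂-≤ : ∀ {L₁ L₂} → Layer 1 Bound₁ L₁ → Layer 2 Bound₂ L₂ →
    length L₁ ℕ.+ (length L₂ ℕ.+ 0) ℕ.≤ Δ ℕ.+ 2
  layers₂-≤ ℓ₁ empty = ℕ.≤-trans (layers₁-≤ ℓ₁) (ℕ.+-monoʳ-≤ Δ (ℕ.n≤1+n 1))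
  layers₂-≤ {L₁} {L₂} ℓ₁ (spanning lo hi lo∈ hi∈ lo≤hi 2n≤) =
    ≤-from-scaled 2 0 ℕ.z<s (combine₂ {+ length L₁} {+ length L₂} {hi - lo} {+ Δ} (below₁₂ ℓ₁ lo∈ hi∈ lo≤hi) 2n≤)

  layers₃-≤ : ∀ {L₁ L₂ L₃} → Layer 1 Bound₁ L₁ → Layer 2 Bound₂ L₂ → Layer 3 Bound₃ L₃ →
    length L₁ ℕ.+ (length L₂ ℕ.+ (length L₃ ℕ.+ 0)) ℕ.≤ Δ ℕ.+ 3
  layers₃-≤ ℓ₁ ℓ₂ empty = ℕ.≤-trans (layers₂-≤ ℓ₁ ℓ₂) (ℕ.+-monoʳ-≤ Δ (ℕ.n≤1+n 2))
  layers₃-≤ {L₁} {L₂} {L₃} ℓ₁ ℓ₂ (spanning lo hi lo∈ hi∈ lo≤hi (3n≤ , _)) =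
    ≤-from-scaled 6 2 (from-yes (2 ℕ.<? 6))
      (combine₃ {+ length L₁} {+ length L₂} {+ length L₃} {hi - lo} {+ Δ}
                (below₁₃ ℓ₁ lo∈ hi∈ lo≤hi) (below₂₃ ℓ₂ lo∈ hi∈ lo≤hi) 3n≤)

ncols-M-≤ : ∀ {Δ r m} (a b : Fin m → ℤ) →
  sum (map (λ i → length (coprimesIn (ℕ.suc (toℕ i)) (a i) (b i))) (allFin m)) ℕ.≤ Δ ℕ.+ r →
  ncols (M m a b) ℕ.≤ Δ ℕ.+ ℕ.suc r
ncols-M-≤ {Δ} {r} {m} a b S≤ rewrite ncols-M m a b | ℕ.+-suc Δ r = s≤s S≤

corollary3p8 : (Δ : ℕ) → 1 ℕ.≤ Δ → (m : ℕ) → 1 ℕ.≤ m → m ℕ.≤ 3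
    → (a b : Fin m → ℤ) → Generic (M m a b) → Submodular Δ (M m a b)
    → ncols (M m a b) ℕ.≤ Δ ℕ.+ (m ℕ.+ 1)
corollary3p8 Δ _ 1 _ _ a b _ sub = ncols-M-≤ a b (layers₁-≤
    (layer (∈-M a b zero) (coprimesIn-extent₁ (a zero) (b zero))))
  where open Counting (minor≤ sub)
corollary3p8 Δ _ 2 _ _ a b _ sub = ncols-M-≤ a b (layers₂-≤
    (layer (∈-M a b zero) (coprimesIn-extent₁ (a zero) (b zero)))
    (layer (∈-M a b (suc zero)) (coprimesIn-extent₂ (a (suc zero)) (b (suc zero)))))
  where open Counting (minor≤ sub)
corollary3p8 Δ _ 3 _ _ a b _ sub = ncols-M-≤ a b (layers₃-≤
    (layer (∈-M a b zero) (coprimesIn-extent₁ (a zero) (b zero)))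
    (layer (∈-M a b (suc zero)) (coprimesIn-extent₂ (a (suc zero)) (b (suc zero))))
    (layer (∈-M a b (suc (suc zero))) (coprimesIn-extent₃ (a (suc (suc zero))) (b (suc (suc zero))))))
  where open Counting (minor≤ sub)
corollary3p8 Δ _ (ℕ.suc (ℕ.suc (ℕ.suc (ℕ.suc _)))) _ (s≤s (s≤s (s≤s ()))) _ _ _ _
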